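{- Let $(G,(A,B,S))$ be a nice structured pair. Then there exists a set $\hat S\subseteq S$ with $|\hat S|\geq|S|/4$ such that for every two distinct nonadjacent $x,y\in\hat S$, either $N_{A\cup B}(x)=N_{A\cup B}(y)$, or both pairs $N_A(x),N_A(y)$ and $N_B(x),N_B(y)$ are incomparable with respect to inclusion.
   Context: All graphs are finite and simple. $N(X)$ is the set of vertices outside $X$ with a neighbour in $X$, $N_Y(X)=N(X)\cap Y$, $N_Y(x)=N_Y(\{x\})$, $N_Y(x,y)=N_Y(\{x,y\})$, $N_S[v]=(N(v)\cup\{v\})\cap S$. A structured pair is $(G,(A,B,S))$ with $A,B,S$ nonempty partitioning $V(G)$, $G[A]$, $G[B]$ connected, $N(A)=N(B)=S$, and for some $\varepsilon>0$, $|N_S[v]|\leq\varepsilon|S|$ for all $v$. It is nice if: (NE1) for every $x\in S$, $A\not\subseteq N(x)$ and $B\not\subseteq N(x)$; (NE2) for all distinct nonadjacent $x,y\in S$, if $N_B(x)\neq N_B(y)$ then there is no edge between $N_A(x)\cap N_A(y)$ and $A\setminus N_A(x,y)$, and the same with $A,B$ swapped; (NE3) for all distinct nonadjacent $x,y\in S$ with $N_A(x)\subsetneq N_A(y)$, every vertex of $N_A(x)$ is adjacent to every vertex of $N_A(y)\setminus N_A(x)$, and the same with $A,B$ swapped; (E1) for all adjacent $x,y\in S$, either $N_A(x)\setminus N_A(y)=\emptyset$ or $N_B(x)\setminus N_B(y)=\emptyset$. -}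

module Defs where

open import Data.Nat using (ℕ; zero; suc; _*_; _≤_; _<_)
open import Data.Bool using (Bool; true; false; _∧_; _∨_; not)
open import Data.Fin using (Fin)
open import Data.Fin.Subset using (Subset; _∈_; _∉_; _⊆_; _∩_; _∪_; _─_; ∣_∣; Nonempty; ⁅_⁆)
import Data.Fin.Subset as Sub
open import Data.Vec using (Vec; tabulate; lookup)
open import Data.Product using (Σ; ∃; _×_; _,_)
open import Data.Sum using (_⊎_)
open import Relation.Nullary using (¬_)
open import Relation.Binary.PropositionalEquality using (_≡_; _≢_)

record Graph (n : ℕ) : Set where
  field
    adj   : Fin n → Fin n → Bool
    sym   : ∀ x y → adj x y ≡ adj y x
    irrfl : ∀ x → adj x x ≡ false

open Graph public

module _ {n : ℕ} (G : Graph n) where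

  Adj : Fin n → Fin n → Set
  Adj x y = adj G x y ≡ true

  NonAdj : Fin n → Fin n → Set
  NonAdj x y = adj G x y ≡ false

  anyFin : ∀ {m} → (Fin m → Bool) → Bool
  anyFin {zero} f = false
  anyFin {suc m} f = f Fin.zero ∨ anyFin (λ i → f (Fin.suc i))

  N : Subset n → Subset n
  N X = tabulate (λ v → not (lookup X v) ∧ anyFin (λ u → lookup X u ∧ adj G v u))

  N₁ : Subset n → Fin n → Subset n
  N₁ Y x = N ⁅ x ⁆ ∩ Y

  N₂ : Subset n → Fin n → Fin n → Subset n
  N₂ Y x y = N (⁅ x ⁆ ∪ ⁅ y ⁆) ∩ Y

  NClosed : Subset n → Fin n → Subset n
  NClosed S v = (N ⁅ v ⁆ ∪ ⁅ v ⁆) ∩ S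

  data WalkIn (X : Subset n) : Fin n → Fin n → Set where
    here : ∀ {u} → u ∈ X → WalkIn X u u
    step : ∀ {u w v} → u ∈ X → Adj u w → WalkIn X w v → WalkIn X u v

  -- G[X] connected (X nonempty is required separately)
  Connected : Subset n → Set
  Connected X = ∀ u v → u ∈ X → v ∈ X → WalkIn X u v

  Partition : Subset n → Subset n → Subset n → Set
  Partition A B S =
    Nonempty A × Nonempty B × Nonempty S ×
    (∀ v → (v ∈ A × v ∉ B × v ∉ S) ⊎ (v ∉ A × v ∈ B × v ∉ S) ⊎ (v ∉ A × v ∉ B × v ∈ S))

  -- structured pair; ε > 0 rational written as p/q with p, q positive naturals
  Structured : Subset n → Subset n → Subset n → Set
  Structured A B S =
    Partition A B S × Connected A × Connected B × N A ≡ S × N B ≡ S ×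
    Σ ℕ (λ p → Σ ℕ (λ q → 0 < p × 0 < q ×
      (∀ v → q * ∣ NClosed S v ∣ ≤ p * ∣ S ∣)))

  _⊊_ : Subset n → Subset n → Set
  P ⊊ Q = P ⊆ Q × P ≢ Q

  NE1 : Subset n → Subset n → Subset n → Set
  NE1 A B S = ∀ x → x ∈ S → ¬ (A ⊆ N ⁅ x ⁆) × ¬ (B ⊆ N ⁅ x ⁆)

  NE2half : Subset n → Subset n → Subset n → Set
  NE2half X Y S = ∀ x y → x ∈ S → y ∈ S → x ≢ y → NonAdj x y →
    N₁ Y x ≢ N₁ Y y →
    ∀ u w → u ∈ (N₁ X x ∩ N₁ X y) → w ∈ (X ─ N₂ X x y) → NonAdj u w

  NE2 : Subset n → Subset n → Subset n → Set
  NE2 A B S = NE2half A B S × NE2half B A S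

  NE3half : Subset n → Subset n → Set
  NE3half X S = ∀ x y → x ∈ S → y ∈ S → x ≢ y → NonAdj x y →
    N₁ X x ⊊ N₁ X y →
    ∀ u w → u ∈ N₁ X x → w ∈ (N₁ X y ─ N₁ X x) → Adj u w

  NE3 : Subset n → Subset n → Subset n → Set
  NE3 A B S = NE3half A S × NE3half B S

  E1 : Subset n → Subset n → Subset n → Set
  E1 A B S = ∀ x y → x ∈ S → y ∈ S → Adj x y →
    (N₁ A x ─ N₁ A y ≡ Sub.⊥) ⊎ (N₁ B x ─ N₁ B y ≡ Sub.⊥)

  Nice : Subset n → Subset n → Subset n → Set
  Nice A B S = Structured A B S × NE1 A B S × NE2 A B S × NE3 A B S × E1 A B S

  Incomparable : Subset n → Subset n → Set
  Incomparable P Q = ¬ (P ⊆ Q) × ¬ (Q ⊆ P)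

-- Call s ∈ S dominated on the side X if some y ∈ S non-adjacent to s has
-- N_X(s) ⊊ N_X(y).  Halving S twice, once by domination on A and once on B,
-- leaves a quarter Ŝ of S on which both properties are constant.  For
-- non-adjacent x, y ∈ Ŝ, a strict inclusion N_X(x) ⊊ N_X(y) would make x
-- dominated, hence y dominated by some z, and the chain x, y, z contradicts
-- NE2 and NE3.  So on each side the neighbourhoods are equal or incomparable;
-- and equality on one side forces equality on the other, since otherwise NE2
-- cuts the connected G[X] between N_X(x) and X ∖ N_X(x), both nonempty by
-- NE1 and N(X) = S.
module Submission where

open import Defs
open import Data.Nat using (ℕ; _*_; _≤_)
open import Data.Fin using (Fin)
open import Data.Fin.Subset using (Subset; _∈_; _⊆_; _∪_; ∣_∣)
open import Data.Product using (Σ; _×_)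
open import Data.Sum using (_⊎_)
open import Relation.Binary.PropositionalEquality using (_≡_; _≢_)

open import Data.Bool as Bool using (Bool; true; false; not; T)
open import Data.Bool.Properties using (T-≡; T-∧; T-∨)
open import Data.Empty using (⊥; ⊥-elim)
open import Data.Fin using (zero; suc)
open import Data.Fin.Properties using (any?)
open import Data.Fin.Subset
  using (inside; outside; _∉_; _⊈_; _⊂_; _∩_; _─_; ∁; Nonempty; ⁅_⁆)
open import Data.Fin.Subset.Properties
  using ( _∈?_; _⊆?_; _⊂?_; ⊆-antisym; ⊆-reflexive; ⊂-irref; p∩q⊆p; p∩q⊆q
        ; x∈p∩q⁺; x∈p∪q⁻; x∈p∧x∉q⇒x∈p─q; x∈∁p⇒x∉p; x∈⁅x⁆; x∈⁅y⁆⇒x≡y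
        ; ∩-distribˡ-∪ )
open import Data.Nat using (suc; _+_)
open import Data.Nat.Properties
  using (+-suc; +-comm; +-identityʳ; +-monoˡ-≤; *-monoʳ-≤; *-assoc; ≤-total; ≤-trans; ≤-reflexive; module ≤-Reasoning)
open import Data.Product using (∃; ∃₂; _,_; proj₁; proj₂)
open import Data.Sum using (inj₁; inj₂)
open import Data.Vec using ([]; _∷_; tabulate; lookup)
open import Data.Vec.Properties using (≡-dec; lookup∘tabulate; []=⇒lookup; lookup⇒[]=)
open import Function using (_∘_; _⇔_; mk⇔; Equivalence)
open import Level using (Level; 0ℓ)
open import Relation.Binary.Definitions using (DecidableEquality)
open import Relation.Binary.PropositionalEquality using (refl; trans; cong; cong₂; subst)
import Relation.Binary.PropositionalEquality as ≡
open import Relation.Nullary using (¬_; yes; no; ¬?; _×-dec_)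
open import Relation.Nullary.Decidable using (isYes; decidable-stable; toWitness; fromWitness)
open import Relation.Unary using (Pred; Decidable)

open Equivalence using (to; from)

private
  variable
    ℓ : Level
    m : ℕ

_≟ˢ_ : DecidableEquality (Subset m)
_≟ˢ_ = ≡-dec Bool._≟_

∈⇔T-lookup : ∀ {p : Subset m} {x} → x ∈ p ⇔ T (lookup p x)
∈⇔T-lookup {p = p} {x} =
  mk⇔ (from T-≡ ∘ []=⇒lookup) (lookup⇒[]= x p ∘ to T-≡)

∈-tabulate : ∀ {f : Fin m → Bool} {x} → x ∈ tabulate f ⇔ T (f x)
∈-tabulate {f = f} {x} =
  mk⇔ (λ x∈ → subst T (lookup∘tabulate f x) (to ∈⇔T-lookup x∈))
      (λ t → from ∈⇔T-lookup (subst T (≡.sym (lookup∘tabulate f x)) t))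

T-not⁺ : ∀ {b} → ¬ T b → T (not b)
T-not⁺ {false} _  = _
T-not⁺ {true}  ¬t = ¬t _

⊈⇒∃∉ : ∀ {p q : Subset m} → p ⊈ q → ∃ λ x → x ∈ p × x ∉ q
⊈⇒∃∉ {p = p} {q} p⊈q with any? (λ x → x ∈? p ×-dec ¬? (x ∈? q))
... | yes witness = witness
... | no ∄ = ⊥-elim (p⊈q λ {x} x∈p →
  decidable-stable (x ∈? q) (λ x∉q → ∄ (x , x∈p , x∉q)))

⊆-compare : ∀ (p q : Subset m) →
  p ⊂ q ⊎ p ≡ q ⊎ q ⊂ p ⊎ (p ⊈ q × q ⊈ p)
⊆-compare p q with p ⊆? q | q ⊆? p
... | yes p⊆q | yes q⊆p = inj₂ (inj₁ (⊆-antisym p⊆q q⊆p))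
... | yes p⊆q | no  q⊈p = inj₁ (p⊆q , ⊈⇒∃∉ q⊈p)
... | no  p⊈q | yes q⊆p = inj₂ (inj₂ (inj₁ (q⊆p , ⊈⇒∃∉ p⊈q)))
... | no  p⊈q | no  q⊈p = inj₂ (inj₂ (inj₂ (p⊈q , q⊈p)))

∣p∣≡∣p∩q∣+∣p∩∁q∣ : ∀ (p q : Subset m) → ∣ p ∣ ≡ ∣ p ∩ q ∣ + ∣ p ∩ ∁ q ∣
∣p∣≡∣p∩q∣+∣p∩∁q∣ [] [] = refl
∣p∣≡∣p∩q∣+∣p∩∁q∣ (outside ∷ p) (_ ∷ q) = ∣p∣≡∣p∩q∣+∣p∩∁q∣ p q
∣p∣≡∣p∩q∣+∣p∩∁q∣ (inside ∷ p) (inside ∷ q) = cong suc (∣p∣≡∣p∩q∣+∣p∩∁q∣ p q)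
∣p∣≡∣p∩q∣+∣p∩∁q∣ (inside ∷ p) (outside ∷ q) =
  trans (cong suc (∣p∣≡∣p∩q∣+∣p∩∁q∣ p q)) (≡.sym (+-suc _ _))

m≤n⇒m+n≤2*n : ∀ {a b} → a ≤ b → a + b ≤ 2 * b
m≤n⇒m+n≤2*n {a} {b} a≤b = begin
  a + b  ≤⟨ +-monoˡ-≤ b a≤b ⟩
  b + b  ≡⟨ cong (b +_) (≡.sym (+-identityʳ b)) ⟩
  2 * b  ∎
  where open ≤-Reasoning

Homogeneous : Pred (Fin m) ℓ → Subset m → Set ℓ
Homogeneous P r = ∀ {x y} → x ∈ r → y ∈ r → P x → P y

module _ {P : Pred (Fin m) ℓ} (P? : Decidable P) where

  private
    satisfying : Subset m
    satisfying = tabulate (isYes ∘ P?)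

    ∈-satisfying⁺ : ∀ {x} → P x → x ∈ satisfying
    ∈-satisfying⁺ {x} = from ∈-tabulate ∘ fromWitness {a? = P? x}

    ∈-satisfying⁻ : ∀ {x} → x ∈ satisfying → P x
    ∈-satisfying⁻ {x} = toWitness {a? = P? x} ∘ to ∈-tabulate

  homogeneous-half : ∀ (p : Subset m) →
    ∃ λ r → r ⊆ p × ∣ p ∣ ≤ 2 * ∣ r ∣ × Homogeneous P r
  homogeneous-half p
    with ∣p∣≡∣p∩q∣+∣p∩∁q∣ p satisfying | ≤-total ∣ p ∩ satisfying ∣ ∣ p ∩ ∁ satisfying ∣
  ... | split | inj₁ sat≤unsat =
    p ∩ ∁ satisfying , p∩q⊆p _ _ ,
    ≤-trans (≤-reflexive split) (m≤n⇒m+n≤2*n sat≤unsat) ,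
    λ x∈r _ Px → ⊥-elim (x∈∁p⇒x∉p (p∩q⊆q _ _ x∈r) (∈-satisfying⁺ Px))
  ... | split | inj₂ unsat≤sat =
    p ∩ satisfying , p∩q⊆p _ _ ,
    ≤-trans (≤-reflexive (trans split (+-comm ∣ p ∩ satisfying ∣ _))) (m≤n⇒m+n≤2*n unsat≤sat) ,
    λ _ y∈r _ → ∈-satisfying⁻ (p∩q⊆q _ _ y∈r)

homogeneous-quarter : ∀ {P Q : Pred (Fin m) ℓ} → Decidable P → Decidable Q →
  ∀ (p : Subset m) →
  ∃ λ r → r ⊆ p × ∣ p ∣ ≤ 4 * ∣ r ∣ × Homogeneous P r × Homogeneous Q r
homogeneous-quarter P? Q? p with homogeneous-half P? p
... | p₁ , p₁⊆p , p≤2p₁ , homP with homogeneous-half Q? p₁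
... | r , r⊆p₁ , p₁≤2r , homQ =
  r , p₁⊆p ∘ r⊆p₁ , p≤4r ,
  (λ x∈r y∈r → homP (r⊆p₁ x∈r) (r⊆p₁ y∈r)) , homQ
  where
  open ≤-Reasoning
  p≤4r : ∣ p ∣ ≤ 4 * ∣ r ∣
  p≤4r = begin
    ∣ p ∣            ≤⟨ p≤2p₁ ⟩
    2 * ∣ p₁ ∣       ≤⟨ *-monoʳ-≤ 2 p₁≤2r ⟩
    2 * (2 * ∣ r ∣)  ≡⟨ *-assoc 2 2 ∣ r ∣ ⟨
    4 * ∣ r ∣        ∎

module _ {n : ℕ} (G : Graph n) where

  private
    variable
      u v w x y z : Fin n
      S X Y : Subset n

  Adj⇒¬NonAdj : Adj G x y → ¬ NonAdj G x y
  Adj⇒¬NonAdj x~y x≁y with trans (≡.sym x~y) x≁y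
  ... | ()

  NonAdj-sym : NonAdj G x y → NonAdj G y x
  NonAdj-sym {x} {y} = trans (Graph.sym G y x)

  ¬Adj-refl : ¬ Adj G x x
  ¬Adj-refl {x} x~x = Adj⇒¬NonAdj x~x (irrfl G x)

  T-anyFin⁻ : ∀ {k} (f : Fin k → Bool) → T (anyFin G f) → ∃ λ i → T (f i)
  T-anyFin⁻ {suc k} f t with to T-∨ t
  ... | inj₁ t₀ = zero , t₀
  ... | inj₂ tₛ with T-anyFin⁻ (f ∘ suc) tₛ
  ...   | i , tᵢ = suc i , tᵢ

  T-anyFin⁺ : ∀ {k} (f : Fin k → Bool) {i} → T (f i) → T (anyFin G f)
  T-anyFin⁺ f {zero}  tᵢ = from T-∨ (inj₁ tᵢ)
  T-anyFin⁺ f {suc i} tᵢ = from T-∨ (inj₂ (T-anyFin⁺ (f ∘ suc) tᵢ))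

  ∈N⁻ : v ∈ N G X → ∃ λ u → u ∈ X × Adj G v u
  ∈N⁻ v∈ with T-anyFin⁻ _ (proj₂ (to T-∧ (to ∈-tabulate v∈)))
  ... | u , t with to T-∧ t
  ...   | u∈X , v~u = u , from ∈⇔T-lookup u∈X , to T-≡ v~u

  ∈N⁺ : v ∉ X → u ∈ X → Adj G v u → v ∈ N G X
  ∈N⁺ {v = v} {X = X} v∉X u∈X v~u = from ∈-tabulate (from T-∧
    ( T-not⁺ (v∉X ∘ from ∈⇔T-lookup)
    , T-anyFin⁺ (λ u → lookup X u Bool.∧ adj G v u)
                (from T-∧ (to ∈⇔T-lookup u∈X , from T-≡ v~u)) ))

  ∈N₁⁺ : Adj G v x → v ∈ Y → v ∈ N₁ G Y x
  ∈N₁⁺ {v} {x} {Y} v~x v∈Y = x∈p∩q⁺ {p = N G ⁅ x ⁆} {q = Y} (∈N⁺ v∉⁅x⁆ (x∈⁅x⁆ x) v~x , v∈Y)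
    where
    v∉⁅x⁆ : v ∉ ⁅ x ⁆
    v∉⁅x⁆ v∈⁅x⁆ with x∈⁅y⁆⇒x≡y x v∈⁅x⁆
    ... | refl = ¬Adj-refl v~x

  ∈N₂⁻ : v ∈ N₂ G Y x y → Adj G v x ⊎ Adj G v y
  ∈N₂⁻ {x = x} {y} v∈ with ∈N⁻ (p∩q⊆p _ _ v∈)
  ... | u , u∈ , v~u with x∈p∪q⁻ ⁅ x ⁆ ⁅ y ⁆ u∈
  ...   | inj₁ u∈⁅x⁆ = inj₁ (subst (Adj G _) (x∈⁅y⁆⇒x≡y x u∈⁅x⁆) v~u)
  ...   | inj₂ u∈⁅y⁆ = inj₂ (subst (Adj G _) (x∈⁅y⁆⇒x≡y y u∈⁅y⁆) v~u)

  ∉N₁⇒∈─N₂ : ∀ x y → w ∈ X → w ∉ N₁ G X x → w ∉ N₁ G X y → w ∈ X ─ N₂ G X x y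
  ∉N₁⇒∈─N₂ {w} {X} x y w∈X w∉x w∉y = x∈p∧x∉q⇒x∈p─q w∈X λ w∈ → case-adj (∈N₂⁻ w∈)
    where
    case-adj : Adj G w x ⊎ Adj G w y → ⊥
    case-adj (inj₁ w~x) = w∉x (∈N₁⁺ w~x w∈X)
    case-adj (inj₂ w~y) = w∉y (∈N₁⁺ w~y w∈X)

  N₁-∪ : ∀ X Y x → N₁ G (X ∪ Y) x ≡ N₁ G X x ∪ N₁ G Y x
  N₁-∪ X Y x = ∩-distribˡ-∪ (N G ⁅ x ⁆) X Y

  N₁-nonempty : N G X ≡ S → x ∈ S → Nonempty (N₁ G X x)
  N₁-nonempty refl x∈NX with ∈N⁻ x∈NX
  ... | u , u∈X , x~u = u , ∈N₁⁺ (trans (Graph.sym G _ _) x~u) u∈X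

  walk-start : WalkIn G X u v → u ∈ X
  walk-start (here u∈X)       = u∈X
  walk-start (step u∈X _ _)   = u∈X

  LeavingEdge : Subset n → Subset n → Set
  LeavingEdge X P = ∃₂ λ a b → a ∈ P × b ∈ X × b ∉ P × Adj G a b

  ∃-edge-leaving : ∀ (P : Subset n) → WalkIn G X u v → u ∈ P → v ∉ P → LeavingEdge X P
  ∃-edge-leaving P (here _) u∈P v∉P = ⊥-elim (v∉P u∈P)
  ∃-edge-leaving P (step {w = w} _ u~w walk) u∈P v∉P with w ∈? P
  ... | yes w∈P = ∃-edge-leaving P walk w∈P v∉P
  ... | no  w∉P = _ , w , u∈P , walk-start walk , w∉P , u~w

  record NiceSide (S X Y : Subset n) : Set where
    field
      connected      : Connected G X
      boundary       : N G X ≡ S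
      not-dominating : ∀ x → x ∈ S → X ⊈ N G ⁅ x ⁆
      ne2            : NE2half G X Y S
      ne3            : NE3half G X S

  nice⇒sides : ∀ {A B S} → Nice G A B S → NiceSide S A B × NiceSide S B A
  nice⇒sides ((_ , connA , connB , NA , NB , _) , ne1 , (ne2A , ne2B) , (ne3A , ne3B) , _) =
    record { connected = connA ; boundary = NA ; not-dominating = λ x x∈S → proj₁ (ne1 x x∈S)
           ; ne2 = ne2A ; ne3 = ne3A } ,
    record { connected = connB ; boundary = NB ; not-dominating = λ x x∈S → proj₂ (ne1 x x∈S)
           ; ne2 = ne2B ; ne3 = ne3B }

  module _ (side : NiceSide S X Y) where
    open NiceSide side

    ∃-edge-leaving-N₁ : x ∈ S → LeavingEdge X (N₁ G X x)
    ∃-edge-leaving-N₁ {x} x∈S with N₁-nonempty boundary x∈S | ⊈⇒∃∉ (not-dominating x x∈S)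
    ... | u , u∈N₁ | w , w∈X , w∉N =
      ∃-edge-leaving (N₁ G X x) (connected u w (p∩q⊆q _ _ u∈N₁) w∈X) u∈N₁ (w∉N ∘ p∩q⊆p _ _)

    N₁-≡-transfer : x ∈ S → y ∈ S → x ≢ y → NonAdj G x y →
      N₁ G X x ≡ N₁ G X y → N₁ G Y x ≡ N₁ G Y y
    N₁-≡-transfer {x} {y} x∈S y∈S x≢y x≁y eq =
      decidable-stable (N₁ G Y x ≟ˢ N₁ G Y y) λ neq → no-cut neq (∃-edge-leaving-N₁ x∈S)
      where
      no-cut : N₁ G Y x ≢ N₁ G Y y → ¬ LeavingEdge X (N₁ G X x)
      no-cut neq (a , b , a∈ , b∈X , b∉ , a~b) =
        Adj⇒¬NonAdj a~b (ne2 x y x∈S y∈S x≢y x≁y neq a b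
          (x∈p∩q⁺ (a∈ , subst (a ∈_) eq a∈))
          (∉N₁⇒∈─N₂ x y b∈X b∉ (subst (b ∉_) eq b∉)))

  Dominated : Subset n → Subset n → Pred (Fin n) 0ℓ
  Dominated S X s = ∃ λ y → y ∈ S × NonAdj G s y × N₁ G X s ⊂ N₁ G X y

  dominated? : ∀ S X → Decidable (Dominated S X)
  dominated? S X s =
    any? λ y → y ∈? S ×-dec adj G s y Bool.≟ false ×-dec N₁ G X s ⊂? N₁ G X y

  N₁-⊂⇒≢ : N₁ G X x ⊂ N₁ G X y → x ≢ y
  N₁-⊂⇒≢ x⊂y refl = ⊂-irref refl x⊂y

  ⊂⇒⊊ : ∀ {p q : Subset n} → p ⊂ q → _⊊_ G p q
  ⊂⇒⊊ p⊂q = proj₁ p⊂q , λ p≡q → ⊂-irref p≡q p⊂q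

  module _ (side : NiceSide S X Y) (other : NiceSide S Y X) where
    open NiceSide side

    dominator-undominated : x ∈ S → y ∈ S → NonAdj G x y →
      N₁ G X x ⊂ N₁ G X y → ¬ Dominated S X y
    dominator-undominated {x} {y} x∈S y∈S x≁y x⊂y@(x⊆y , _) (z , z∈S , y≁z , y⊂z@(_ , w , w∈z , w∉y))
      with N₁-nonempty boundary x∈S
    ... | u , u∈x = Adj⇒¬NonAdj u~w u≁w
      where
      Y-differs : N₁ G Y x ≢ N₁ G Y y
      Y-differs eq = ⊂-irref (N₁-≡-transfer other x∈S y∈S (N₁-⊂⇒≢ x⊂y) x≁y eq) x⊂y

      u≁w : NonAdj G u w
      u≁w = ne2 x y x∈S y∈S (N₁-⊂⇒≢ x⊂y) x≁y Y-differs u w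
        (x∈p∩q⁺ (u∈x , x⊆y u∈x))
        (∉N₁⇒∈─N₂ x y (p∩q⊆q _ _ w∈z) (w∉y ∘ x⊆y) w∉y)

      u~w : Adj G u w
      u~w = ne3 y z y∈S z∈S (N₁-⊂⇒≢ y⊂z) y≁z (⊂⇒⊊ y⊂z) u w (x⊆y u∈x) (x∈p∧x∉q⇒x∈p─q w∈z w∉y)

    N₁-≡-or-incomparable : x ∈ S → y ∈ S → NonAdj G x y →
      (Dominated S X x → Dominated S X y) → (Dominated S X y → Dominated S X x) →
      N₁ G X x ≡ N₁ G X y ⊎ Incomparable G (N₁ G X x) (N₁ G X y)
    N₁-≡-or-incomparable {x} {y} x∈S y∈S x≁y x→y y→x with ⊆-compare (N₁ G X x) (N₁ G X y)
    ... | inj₁ x⊂y = ⊥-elim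
      (dominator-undominated x∈S y∈S x≁y x⊂y (x→y (y , y∈S , x≁y , x⊂y)))
    ... | inj₂ (inj₁ eq) = inj₁ eq
    ... | inj₂ (inj₂ (inj₁ y⊂x)) = ⊥-elim
      (dominator-undominated y∈S x∈S (NonAdj-sym x≁y) y⊂x (y→x (x , x∈S , NonAdj-sym x≁y , y⊂x)))
    ... | inj₂ (inj₂ (inj₂ incomparable)) = inj₂ incomparable

  incomparable⇒≢ : ∀ {p q : Subset n} → Incomparable G p q → p ≢ q
  incomparable⇒≢ (p⊈q , _) p≡q = p⊈q (⊆-reflexive p≡q)

  Separated : Subset n → Subset n → Fin n → Fin n → Set
  Separated A B x y =
    N₁ G (A ∪ B) x ≡ N₁ G (A ∪ B) y
      ⊎ (Incomparable G (N₁ G A x) (N₁ G A y) × Incomparable G (N₁ G B x) (N₁ G B y))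

  combine-sides : ∀ {A B S} → NiceSide S A B → NiceSide S B A →
    x ∈ S → y ∈ S → x ≢ y → NonAdj G x y →
    N₁ G A x ≡ N₁ G A y ⊎ Incomparable G (N₁ G A x) (N₁ G A y) →
    N₁ G B x ≡ N₁ G B y ⊎ Incomparable G (N₁ G B x) (N₁ G B y) →
    Separated A B x y
  combine-sides {x} {y} {A} {B} _ _ _ _ _ _ (inj₁ eqA) (inj₁ eqB) = inj₁ (begin
    N₁ G (A ∪ B) x           ≡⟨ N₁-∪ A B x ⟩
    N₁ G A x ∪ N₁ G B x      ≡⟨ cong₂ _∪_ eqA eqB ⟩
    N₁ G A y ∪ N₁ G B y      ≡⟨ N₁-∪ A B y ⟨
    N₁ G (A ∪ B) y           ∎)
    where open ≡.≡-Reasoning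
  combine-sides sideA _ x∈S y∈S x≢y x≁y (inj₁ eqA) (inj₂ incB) =
    ⊥-elim (incomparable⇒≢ incB (N₁-≡-transfer sideA x∈S y∈S x≢y x≁y eqA))
  combine-sides _ sideB x∈S y∈S x≢y x≁y (inj₂ incA) (inj₁ eqB) =
    ⊥-elim (incomparable⇒≢ incA (N₁-≡-transfer sideB x∈S y∈S x≢y x≁y eqB))
  combine-sides _ _ _ _ _ _ (inj₂ incA) (inj₂ incB) = inj₂ (incA , incB)

  homogeneous⇒separated : ∀ {A B S Ŝ} → Nice G A B S → Ŝ ⊆ S →
    Homogeneous (Dominated S A) Ŝ → Homogeneous (Dominated S B) Ŝ →
    x ∈ Ŝ → y ∈ Ŝ → x ≢ y → NonAdj G x y → Separated A B x y
  homogeneous⇒separated {x} {y} {A} {B} {S} nice Ŝ⊆S homA homB x∈Ŝ y∈Ŝ x≢y x≁y =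
    combine-sides sideA sideB x∈S y∈S x≢y x≁y
      (N₁-≡-or-incomparable sideA sideB x∈S y∈S x≁y (homA x∈Ŝ y∈Ŝ) (homA y∈Ŝ x∈Ŝ))
      (N₁-≡-or-incomparable sideB sideA x∈S y∈S x≁y (homB x∈Ŝ y∈Ŝ) (homB y∈Ŝ x∈Ŝ))
    where
    sideA : NiceSide S A B
    sideA = proj₁ (nice⇒sides nice)
    sideB : NiceSide S B A
    sideB = proj₂ (nice⇒sides nice)
    x∈S : x ∈ S
    x∈S = Ŝ⊆S x∈Ŝ
    y∈S : y ∈ S
    y∈S = Ŝ⊆S y∈Ŝ

lemma5p4 : ∀ {n} (G : Graph n) (A B S : Subset n) → Nice G A B S →
    Σ (Subset n) (λ Ŝ → Ŝ ⊆ S × ∣ S ∣ ≤ 4 * ∣ Ŝ ∣ ×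
      (∀ x y → x ∈ Ŝ → y ∈ Ŝ → x ≢ y → NonAdj G x y →
        (N₁ G (A ∪ B) x ≡ N₁ G (A ∪ B) y)
        ⊎ (Incomparable G (N₁ G A x) (N₁ G A y) × Incomparable G (N₁ G B x) (N₁ G B y))))
lemma5p4 G A B S nice =
  let Ŝ , Ŝ⊆S , |S|≤4|Ŝ| , homA , homB =
        homogeneous-quarter (dominated? G S A) (dominated? G S B) S
  in Ŝ , Ŝ⊆S , |S|≤4|Ŝ| , λ _ _ → homogeneous⇒separated G nice Ŝ⊆S homA homB
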